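{- Let $\ell\ge2$ and let $L=[\delta_{ij}]_{i,j\in[\ell]}$ be a Latin square of order $\ell$ with symbols in $[\ell]=\{1,\ldots,\ell\}$. For each $a\in[\ell]$ let $S^{(a)}$ be a multiset of $n_S$ vectors in $\mathbb{Q}^{r_S}$ and $T^{(a)}$ a multiset of $n_T$ vectors in $\mathbb{Q}^{r_T}$, and define the multiset $U^{(a)}=\bigcup_{i=1}^{\ell}S^{(i)}\times T^{(\delta_{ai})}\subset\mathbb{Q}^{r_S+r_T}$ (multiset union of $\ell n_Sn_T$ vectors). Suppose that $[S^{(a)}]=^{n_S}_{m_S}[S^{(b)}]$ and $[T^{(a)}]=^{n_T}_{m_T}[T^{(b)}]$ for all distinct $a,b\in[\ell]$. Then $[U^{(a)}]=^{\ell n_Sn_T}_{m_S+m_T+1}[U^{(b)}]$ for all distinct $a,b\in[\ell]$.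
   Context: A Latin square of order $\ell$ is an $\ell\times\ell$ array with $\ell$ symbols in which each symbol appears exactly once in each row and each column. For multisets $S\subset\mathbb{Q}^{r_S}$, $T\subset\mathbb{Q}^{r_T}$, $S\times T$ is the multiset of all concatenations $(s_1,\ldots,s_{r_S},t_1,\ldots,t_{r_T})$ with $\mathbf{s}\in S$, $\mathbf{t}\in T$ (counted with multiplicity). For multisets $A=\{\mathbf{a}_1,\ldots,\mathbf{a}_n\}$, $B=\{\mathbf{b}_1,\ldots,\mathbf{b}_n\}\subset\mathbb{Q}^r$ with $\mathbf{a}_i=(a_{i1},\ldots,a_{ir})$, $\mathbf{b}_i=(b_{i1},\ldots,b_{ir})$, $[A]=^n_m[B]$ means $A,B$ have no common element and $\sum_i\prod_j a_{ij}^{k_j}=\sum_i\prod_j b_{ij}^{k_j}$ for all nonnegative integers $k_j$ with $1\le\sum_jk_j\le m$. -}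

module Defs where

open import Data.Nat as ℕ using (ℕ; zero; suc)
open import Data.Rational using (ℚ; 0ℚ; 1ℚ; _+_; _*_)
open import Data.Fin using (Fin)
open import Data.Vec as Vec using (Vec; []; _∷_; _++_; concat; map; tabulate; zipWith; foldr)
open import Data.Vec.Membership.Propositional using (_∈_)
open import Data.Product using (Σ; _×_; _,_)
open import Relation.Binary.PropositionalEquality using (_≡_)
open import Relation.Nullary using (¬_)

_^_ : ℚ → ℕ → ℚ
q ^ zero  = 1ℚ
q ^ suc k = q * (q ^ k)

monomial : ∀ {r} → Vec ℚ r → Vec ℕ r → ℚ
monomial a k = foldr _ _*_ 1ℚ (zipWith _^_ a k)

-- ∑_i ∏_j a_{ij}^{k_j}  over a multiset (given as a vector listing elements with multiplicity)
powerSum : ∀ {r n} → Vec (Vec ℚ r) n → Vec ℕ r → ℚ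
powerSum A k = foldr _ _+_ 0ℚ (map (λ a → monomial a k) A)

EqPow : ∀ {r} (n m : ℕ) → Vec (Vec ℚ r) n → Vec (Vec ℚ r) n → Set
EqPow {r} n m A B =
  (∀ x → x ∈ A → ¬ (x ∈ B)) ×
  (∀ (k : Vec ℕ r) → 1 ℕ.≤ Vec.sum k → Vec.sum k ℕ.≤ m → powerSum A k ≡ powerSum B k)

IsLatinSquare : ∀ {ℓ} → (Fin ℓ → Fin ℓ → Fin ℓ) → Set
IsLatinSquare {ℓ} δ =
  (∀ (i s : Fin ℓ) → Σ (Fin ℓ) λ j → δ i j ≡ s × (∀ j′ → δ i j′ ≡ s → j′ ≡ j)) ×
  (∀ (j s : Fin ℓ) → Σ (Fin ℓ) λ i → δ i j ≡ s × (∀ i′ → δ i′ j ≡ s → i′ ≡ i))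

_⊠_ : ∀ {rS rT nS nT} → Vec (Vec ℚ rS) nS → Vec (Vec ℚ rT) nT → Vec (Vec ℚ (rS ℕ.+ rT)) (nS ℕ.* nT)
S ⊠ T = concat (map (λ s → map (λ t → s ++ t) T) S)

U : ∀ {ℓ rS rT nS nT} → (Fin ℓ → Fin ℓ → Fin ℓ) →
    (Fin ℓ → Vec (Vec ℚ rS) nS) → (Fin ℓ → Vec (Vec ℚ rT) nT) →
    Fin ℓ → Vec (Vec ℚ (rS ℕ.+ rT)) (ℓ ℕ.* (nS ℕ.* nT))
U δ S T a = concat (tabulate (λ i → S i ⊠ T (δ a i)))

{-# OPTIONS --safe #-}

-- Power sums are additive over multiset unions and multiplicative over S ⊠ T once the
-- exponent is split as kS ++ kT, so the power sum of U^(a) at kS ++ kT is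
-- ∑ᵢ p_S(i) · p_T(δ a i).  If kS ++ kT has degree ≤ mS + mT + 1, then either kS has
-- degree ≤ mS, so p_S(i) does not depend on i and row a of the Latin square merely
-- permutes the T-factors, or kT has degree ≤ mT and the T-factors themselves do not
-- depend on the block.  Either way the power sum does not depend on a.

module Submission where

open import Defs
open import Data.Nat using (ℕ; _≤_; _+_; _*_)
open import Data.Fin using (Fin; zero; suc; _≟_)
open import Data.Vec as Vec using (Vec; []; _∷_; _++_; concat; tabulate; splitAt)
open import Data.Rational as ℚ using (ℚ)
open import Relation.Binary.PropositionalEquality using (_≢_)

import Data.Nat as ℕ
import Data.Nat.Properties as ℕ
open import Data.Rational.Properties
  using (+-identityˡ; +-assoc; *-identityˡ; *-assoc; *-zeroˡ; *-zeroʳ;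
         *-distribˡ-+; *-distribʳ-+; +-0-commutativeMonoid)
open import Data.Fin.Permutation using (Permutation; permutation)
import Data.Vec.Properties as Vec
import Data.Vec.Relation.Unary.Any.Properties as Any
open import Data.Vec.Membership.Propositional using (_∈_; find)
open import Data.Product using (∃; ∃₂; _×_; _,_; proj₁; proj₂)
open import Data.Sum using (_⊎_; inj₁; inj₂)
open import Relation.Nullary using (yes; no; ¬_)
open import Relation.Binary.PropositionalEquality
  using (_≡_; refl; sym; trans; cong; cong₂; subst; module ≡-Reasoning)
open import Algebra.Properties.CommutativeMonoid.Sum +-0-commutativeMonoid
  using (sum-syntax; sum-cong-≗; ∑-permute)

powerSum-++ : ∀ {r m n} (A : Vec (Vec ℚ r) m) (B : Vec (Vec ℚ r) n) k →
              powerSum (A ++ B) k ≡ powerSum A k ℚ.+ powerSum B k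
powerSum-++ []      B k = sym (+-identityˡ _)
powerSum-++ (a ∷ A) B k = begin
  monomial a k ℚ.+ powerSum (A ++ B) k                 ≡⟨ cong (monomial a k ℚ.+_) (powerSum-++ A B k) ⟩
  monomial a k ℚ.+ (powerSum A k ℚ.+ powerSum B k)     ≡⟨ +-assoc (monomial a k) _ _ ⟨
  monomial a k ℚ.+ powerSum A k ℚ.+ powerSum B k       ∎
  where open ≡-Reasoning

powerSum-concat-tabulate : ∀ {r n} ℓ (f : Fin ℓ → Vec (Vec ℚ r) n) k →
                           powerSum (concat (tabulate f)) k ≡ ∑[ i < ℓ ] powerSum (f i) k
powerSum-concat-tabulate ℕ.zero    f k = refl
powerSum-concat-tabulate (ℕ.suc ℓ) f k =
  trans (powerSum-++ (f zero) _ k)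
        (cong (powerSum (f zero) k ℚ.+_) (powerSum-concat-tabulate ℓ (λ i → f (suc i)) k))

monomial-++ : ∀ {rS rT} (s : Vec ℚ rS) (t : Vec ℚ rT) kS kT →
              monomial (s ++ t) (kS ++ kT) ≡ monomial s kS ℚ.* monomial t kT
monomial-++ []      t []       kT = sym (*-identityˡ _)
monomial-++ (x ∷ s) t (k ∷ kS) kT =
  trans (cong ((x ^ k) ℚ.*_) (monomial-++ s t kS kT)) (sym (*-assoc (x ^ k) _ _))

powerSum-⊠ : ∀ {rS rT nS nT} (S : Vec (Vec ℚ rS) nS) (T : Vec (Vec ℚ rT) nT) kS kT →
             powerSum (S ⊠ T) (kS ++ kT) ≡ powerSum S kS ℚ.* powerSum T kT
powerSum-⊠           []      T kS kT = sym (*-zeroˡ (powerSum T kT))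
powerSum-⊠ {rT = rT} (s ∷ S) T kS kT = begin
  powerSum (Vec.map (s ++_) T ++ S ⊠ T) (kS ++ kT)
    ≡⟨ powerSum-++ (Vec.map (s ++_) T) (S ⊠ T) (kS ++ kT) ⟩
  powerSum (Vec.map (s ++_) T) (kS ++ kT) ℚ.+ powerSum (S ⊠ T) (kS ++ kT)
    ≡⟨ cong₂ ℚ._+_ (powerSum-prefix T) (powerSum-⊠ S T kS kT) ⟩
  monomial s kS ℚ.* powerSum T kT ℚ.+ powerSum S kS ℚ.* powerSum T kT
    ≡⟨ *-distribʳ-+ (powerSum T kT) (monomial s kS) (powerSum S kS) ⟨
  (monomial s kS ℚ.+ powerSum S kS) ℚ.* powerSum T kT
    ∎
  where
  open ≡-Reasoning

  powerSum-prefix : ∀ {n} (T : Vec (Vec ℚ rT) n) →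
                    powerSum (Vec.map (s ++_) T) (kS ++ kT) ≡ monomial s kS ℚ.* powerSum T kT
  powerSum-prefix []      = sym (*-zeroʳ (monomial s kS))
  powerSum-prefix (t ∷ T) =
    trans (cong₂ ℚ._+_ (monomial-++ s t kS kT) (powerSum-prefix T))
          (sym (*-distribˡ-+ (monomial s kS) _ _))

monomial-degree0 : ∀ {r} (a : Vec ℚ r) k → Vec.sum k ≡ 0 → monomial a k ≡ ℚ.1ℚ
monomial-degree0 []      []       _ = refl
monomial-degree0 (x ∷ a) (k ∷ ks) Σk≡0 rewrite ℕ.m+n≡0⇒m≡0 k Σk≡0 =
  trans (*-identityˡ _) (monomial-degree0 a ks (ℕ.m+n≡0⇒n≡0 k Σk≡0))

powerSum-degree0 : ∀ {r n} (A B : Vec (Vec ℚ r) n) k → Vec.sum k ≡ 0 →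
                   powerSum A k ≡ powerSum B k
powerSum-degree0 []      []      k Σk≡0 = refl
powerSum-degree0 (a ∷ A) (b ∷ B) k Σk≡0 =
  cong₂ ℚ._+_ (trans (monomial-degree0 a k Σk≡0) (sym (monomial-degree0 b k Σk≡0)))
              (powerSum-degree0 A B k Σk≡0)

powerSum-invariant : ∀ {ℓ r n m} (S : Fin ℓ → Vec (Vec ℚ r) n) →
                     (∀ a b → a ≢ b → EqPow n m (S a) (S b)) →
                     ∀ k → Vec.sum k ≤ m → ∀ a b → powerSum (S a) k ≡ powerSum (S b) k
powerSum-invariant S S≡ k Σk≤m a b with a ≟ b | Vec.sum k in Σk≡
... | yes refl | _       = refl
... | no _     | ℕ.zero  = powerSum-degree0 (S a) (S b) k Σk≡
... | no a≢b   | ℕ.suc _ =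
  proj₂ (S≡ a b a≢b) k (subst (1 ≤_) (sym Σk≡) (ℕ.s≤s ℕ.z≤n)) (subst (_≤ _) (sym Σk≡) Σk≤m)

∈-⊠⁻ : ∀ {rS rT nS nT} (S : Vec (Vec ℚ rS) nS) (T : Vec (Vec ℚ rT) nT) {v} →
       v ∈ S ⊠ T → ∃₂ λ s t → s ∈ S × t ∈ T × v ≡ s ++ t
∈-⊠⁻ S T v∈S⊠T with find (Any.map⁻ (Any.concat⁻ (Vec.map (λ s → Vec.map (s ++_) T) S) v∈S⊠T))
... | s , s∈S , v∈s++T with find (Any.map⁻ v∈s++T)
... | t , t∈T , v≡s++t = s , t , s∈S , t∈T , v≡s++t

degree-split : ∀ {p q} mS mT → p + q ≤ mS + mT + 1 → p ≤ mS ⊎ q ≤ mT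
degree-split {p} {q} mS mT p+q≤ with p ℕ.≤? mS
... | yes p≤mS = inj₁ p≤mS
... | no  p≰mS = inj₂ (ℕ.+-cancelˡ-≤ (ℕ.suc mS) q mT (begin
  ℕ.suc mS + q   ≤⟨ ℕ.+-monoˡ-≤ q (ℕ.≰⇒> p≰mS) ⟩
  p + q          ≤⟨ p+q≤ ⟩
  mS + mT + 1    ≡⟨ ℕ.+-comm (mS + mT) 1 ⟩
  ℕ.suc mS + mT  ∎))
  where open ℕ.≤-Reasoning

module _ {ℓ} {δ : Fin ℓ → Fin ℓ → Fin ℓ} (latin : IsLatinSquare δ) where

  ∑-latin-row : ∀ x (f : Fin ℓ → ℚ) → ∑[ i < ℓ ] f (δ x i) ≡ ∑[ j < ℓ ] f j
  ∑-latin-row x f = sym (∑-permute f row)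
    where
    row : Permutation ℓ ℓ
    row = permutation (δ x) (λ s → proj₁ (proj₁ latin x s)) (λ s → proj₁ (proj₂ (proj₁ latin x s)))
                      (λ j → sym (proj₂ (proj₂ (proj₁ latin x (δ x j))) j refl))

  latin-column-injective : ∀ {a b} i → δ a i ≡ δ b i → a ≡ b
  latin-column-injective {a} {b} i δai≡δbi with proj₂ latin i (δ a i)
  ... | _ , _ , unique = trans (unique a refl) (sym (unique b (sym δai≡δbi)))

module _ {ℓ rS rT nS nT} (δ : Fin ℓ → Fin ℓ → Fin ℓ)
         (S : Fin ℓ → Vec (Vec ℚ rS) nS) (T : Fin ℓ → Vec (Vec ℚ rT) nT) where

  ∈-U⁻ : ∀ x {v} → v ∈ U δ S T x →
         ∃ λ i → ∃₂ λ s t → s ∈ S i × t ∈ T (δ x i) × v ≡ s ++ t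
  ∈-U⁻ x v∈U with Any.tabulate⁻ (Any.concat⁻ (tabulate (λ i → S i ⊠ T (δ x i))) v∈U)
  ... | i , v∈Si⊠T = i , ∈-⊠⁻ (S i) (T (δ x i)) v∈Si⊠T

  -- A common element s ++ t must take s from a single block S i, and the two
  -- T-blocks paired with S i differ because column i of a Latin square has no repeats.
  U-disjoint : IsLatinSquare δ →
               (∀ i j → i ≢ j → ∀ s → s ∈ S i → ¬ s ∈ S j) →
               (∀ i j → i ≢ j → ∀ t → t ∈ T i → ¬ t ∈ T j) →
               ∀ {a b} → a ≢ b → ∀ v → v ∈ U δ S T a → ¬ v ∈ U δ S T b
  U-disjoint latin S# T# {a} {b} a≢b v v∈Ua v∈Ub with ∈-U⁻ a v∈Ua | ∈-U⁻ b v∈Ub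
  ... | i , s , t , s∈Si , t∈T , refl | j , s′ , t′ , s′∈Sj , t′∈T , s++t≡s′++t′
    with Vec.++-injective s s′ s++t≡s′++t′
  ... | refl , refl with i ≟ j
  ... | no  i≢j  = S# i j i≢j s s∈Si s′∈Sj
  ... | yes refl = T# (δ a i) (δ b i) (λ δai≡δbi → a≢b (latin-column-injective latin i δai≡δbi))
                      t t∈T t′∈T

  powerSum-U : ∀ x kS kT →
               powerSum (U δ S T x) (kS ++ kT) ≡ ∑[ i < ℓ ] (powerSum (S i) kS ℚ.* powerSum (T (δ x i)) kT)
  powerSum-U x kS kT =
    trans (powerSum-concat-tabulate ℓ (λ i → S i ⊠ T (δ x i)) (kS ++ kT))
          (sum-cong-≗ (λ i → powerSum-⊠ (S i) (T (δ x i)) kS kT))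

  powerSum-U-invariantˡ : IsLatinSquare δ → ∀ kS kT →
                          (∀ i j → powerSum (S i) kS ≡ powerSum (S j) kS) →
                          ∀ a b → powerSum (U δ S T a) (kS ++ kT) ≡ powerSum (U δ S T b) (kS ++ kT)
  powerSum-U-invariantˡ latin kS kT pS≡ a b = trans (rowSum a) (sym (rowSum b))
    where
    open ≡-Reasoning
    pS : Fin ℓ → ℚ
    pS i = powerSum (S i) kS
    pT : Fin ℓ → ℚ
    pT j = powerSum (T j) kT
    rowSum : ∀ x → powerSum (U δ S T x) (kS ++ kT) ≡ ∑[ j < ℓ ] (pS a ℚ.* pT j)
    rowSum x = begin
      powerSum (U δ S T x) (kS ++ kT)     ≡⟨ powerSum-U x kS kT ⟩
      ∑[ i < ℓ ] (pS i ℚ.* pT (δ x i))    ≡⟨ sum-cong-≗ (λ i → cong (ℚ._* pT (δ x i)) (pS≡ i a)) ⟩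
      ∑[ i < ℓ ] (pS a ℚ.* pT (δ x i))    ≡⟨ ∑-latin-row latin x (λ j → pS a ℚ.* pT j) ⟩
      ∑[ j < ℓ ] (pS a ℚ.* pT j)          ∎

  powerSum-U-invariantʳ : ∀ kS kT →
                          (∀ i j → powerSum (T i) kT ≡ powerSum (T j) kT) →
                          ∀ a b → powerSum (U δ S T a) (kS ++ kT) ≡ powerSum (U δ S T b) (kS ++ kT)
  powerSum-U-invariantʳ kS kT pT≡ a b = begin
    powerSum (U δ S T a) (kS ++ kT)                              ≡⟨ powerSum-U a kS kT ⟩
    ∑[ i < ℓ ] (powerSum (S i) kS ℚ.* powerSum (T (δ a i)) kT)   ≡⟨ sum-cong-≗ (λ i → cong (powerSum (S i) kS ℚ.*_) (pT≡ (δ a i) (δ b i))) ⟩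
    ∑[ i < ℓ ] (powerSum (S i) kS ℚ.* powerSum (T (δ b i)) kT)   ≡⟨ powerSum-U b kS kT ⟨
    powerSum (U δ S T b) (kS ++ kT)                              ∎
    where open ≡-Reasoning

  powerSum-U-invariant : ∀ {mS mT} → IsLatinSquare δ →
                         (∀ a b → a ≢ b → EqPow nS mS (S a) (S b)) →
                         (∀ a b → a ≢ b → EqPow nT mT (T a) (T b)) →
                         ∀ kS kT → Vec.sum kS + Vec.sum kT ≤ mS + mT + 1 →
                         ∀ a b → powerSum (U δ S T a) (kS ++ kT) ≡ powerSum (U δ S T b) (kS ++ kT)
  powerSum-U-invariant {mS} {mT} latin S≡ T≡ kS kT deg with degree-split mS mT deg
  ... | inj₁ ΣkS≤mS = powerSum-U-invariantˡ latin kS kT (powerSum-invariant S S≡ kS ΣkS≤mS)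
  ... | inj₂ ΣkT≤mT = powerSum-U-invariantʳ kS kT (powerSum-invariant T T≡ kT ΣkT≤mT)

theorem5p8 : (ℓ : ℕ) → 2 ≤ ℓ →
    (δ : Fin ℓ → Fin ℓ → Fin ℓ) → IsLatinSquare δ →
    (rS rT nS nT mS mT : ℕ) →
    (S : Fin ℓ → Vec (Vec ℚ rS) nS) → (T : Fin ℓ → Vec (Vec ℚ rT) nT) →
    (∀ a b → a ≢ b → EqPow nS mS (S a) (S b)) →
    (∀ a b → a ≢ b → EqPow nT mT (T a) (T b)) →
    ∀ a b → a ≢ b → EqPow (ℓ * (nS * nT)) (mS + mT + 1) (U δ S T a) (U δ S T b)
theorem5p8 ℓ _ δ latin rS rT nS nT mS mT S T S≡ T≡ a b a≢b =
  U-disjoint δ S T latin (λ i j i≢j → proj₁ (S≡ i j i≢j)) (λ i j i≢j → proj₁ (T≡ i j i≢j)) a≢b ,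
  powerSums
  where
  powerSums : ∀ k → 1 ≤ Vec.sum k → Vec.sum k ≤ mS + mT + 1 →
              powerSum (U δ S T a) k ≡ powerSum (U δ S T b) k
  powerSums k _ deg with splitAt rS k
  ... | kS , kT , refl =
    powerSum-U-invariant δ S T latin S≡ T≡ kS kT (subst (_≤ mS + mT + 1) (Vec.sum-++ kS) deg) a b
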